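{- Let $P$ be a non-empty set and $\mathcal{L}$ a set of formulae with semantic function $[\![\cdot]\!]:\mathcal{L}\to\mathcal{P}(P)$ such that $\mathcal{L}(p)\neq\emptyset$ for every $p\in P$. If $\phi\in\mathcal{L}$ is characteristic for some $p\in P$, then $\phi$ is prime and consistent.
   Context: For $p\in P$, $\mathcal{L}(p)=\{\phi\in\mathcal{L}\mid p\in[\![\phi]\!]\}$. A formula $\phi$ is consistent iff $[\![\phi]\!]\neq\emptyset$. A formula $\phi$ is characteristic for $p\in P$ iff for all $q\in P$: $q\in[\![\phi]\!]$ if and only if $\mathcal{L}(p)\subseteq\mathcal{L}(q)$. A formula $\phi$ is prime iff for every non-empty finite set $\Psi\subseteq\mathcal{L}$, $[\![\phi]\!]\subseteq\bigcup_{\psi\in\Psi}[\![\psi]\!]$ implies $[\![\phi]\!]\subseteq[\![\psi]\!]$ for some $\psi\in\Psi$. -}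

module Defs where

open import Level using (Level; _⊔_; suc)
open import Data.Product using (Σ; ∃; _×_)
open import Data.List.NonEmpty using (List⁺; toList)
open import Data.List.Relation.Unary.Any using (Any)

-- A logic over a set of processes P: formulae L and semantics ⟦_⟧ : L → 𝒫(P),
-- where a subset of P is represented as a predicate P → Set.
module Logic {a b c : Level} (P : Set a) (L : Set b) (⟦_⟧ : L → P → Set c) where

  _⊑_ : P → P → Set (b ⊔ c)
  p ⊑ q = ∀ (φ : L) → ⟦ φ ⟧ p → ⟦ φ ⟧ q

  Consistent : L → Set (a ⊔ c)
  Consistent φ = ∃ λ (q : P) → ⟦ φ ⟧ q

  Characteristic : L → P → Set (a ⊔ b ⊔ c)
  Characteristic φ p = ∀ (q : P) → (⟦ φ ⟧ q → p ⊑ q) × (p ⊑ q → ⟦ φ ⟧ q)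

  Prime : L → Set (a ⊔ b ⊔ c)
  Prime φ = ∀ (Ψ : List⁺ L) →
            (∀ (q : P) → ⟦ φ ⟧ q → Any (λ ψ → ⟦ ψ ⟧ q) (toList Ψ)) →
            Any (λ ψ → ∀ (q : P) → ⟦ φ ⟧ q → ⟦ ψ ⟧ q) (toList Ψ)

{-# OPTIONS --safe #-}
module Submission where

open import Defs
open import Level using (Level)
open import Data.Product using (∃; _×_; _,_; proj₁; proj₂)
open import Data.List.Relation.Unary.Any as Any using ()

-- A characteristic formula for p holds at p itself, and every process satisfying it
-- is ⊑-above p.  So whichever ψ ∈ Ψ covers p also covers all of ⟦φ⟧.

module CharacteristicFormulae {a b c : Level} (P : Set a) (L : Set b) (⟦_⟧ : L → P → Set c) where

  open Logic P L ⟦_⟧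

  ⊑-refl : ∀ {p} → p ⊑ p
  ⊑-refl ψ pψ = pψ

  characteristic⇒satisfied : ∀ {φ p} → Characteristic φ p → ⟦ φ ⟧ p
  characteristic⇒satisfied {p = p} ch = proj₂ (ch p) ⊑-refl

  characteristic⇒consistent : ∀ {φ p} → Characteristic φ p → Consistent φ
  characteristic⇒consistent {p = p} ch = p , characteristic⇒satisfied ch

  characteristic⇒prime : ∀ {φ p} → Characteristic φ p → Prime φ
  characteristic⇒prime {p = p} ch Ψ covers =
    Any.map (λ {ψ} pψ q φq → proj₁ (ch q) φq ψ pψ) (covers p (characteristic⇒satisfied ch))

open CharacteristicFormulae

mainTheorem1 : ∀ {a b c : Level} (P : Set a) (L : Set b) (⟦_⟧ : L → P → Set c) →
    P →
    (∀ (p : P) → ∃ λ (φ : L) → ⟦ φ ⟧ p) →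
    ∀ (φ : L) → (∃ λ (p : P) → Logic.Characteristic P L ⟦_⟧ φ p) →
    Logic.Prime P L ⟦_⟧ φ × Logic.Consistent P L ⟦_⟧ φ
mainTheorem1 P L ⟦_⟧ _ _ _ (_ , ch) =
  characteristic⇒prime P L ⟦_⟧ ch , characteristic⇒consistent P L ⟦_⟧ ch
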